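{- Let $\mathcal T$ be a tangle of order $k$ in a connectivity system $(E,\lambda)$, and let $\mathcal S$ be a tree compatible set. Let $n\ge2$, and let $\Phi=(P_1,\dots,P_n)$ be a $k$-flower in $\mathcal T$. If $P_1\subseteq\mathrm{fcl}_{\mathcal T}(P_2)$, then the concatenation $\Phi'=(P_1\cup P_2,P_3,\dots,P_n)$ of $\Phi$ is $\mathcal T$-equivalent to $\Phi$ with respect to $\mathcal S$.
   Context: A connectivity system is a pair $(E,\lambda)$ with $E$ finite and $\lambda$ an integer-valued symmetric ($\lambda(X)=\lambda(E-X)$) submodular function on subsets of $E$. $X$ is $k$-separating if $\lambda(X)\le k$; a $k$-separation is an unordered partition $(X,E-X)$ (parts may be empty) with $\lambda(X)\le k$. A tangle of order $k$ is a collection $\mathcal T$ of subsets of $E$ with (T1) $\lambda(A)<k$ for $A\in\mathcal T$; (T2) if $\lambda(A)\le k-1$ then $A\in\mathcal T$ or $E-A\in\mathcal T$; (T3) no three members have union $E$; (T4) $E-\{e\}\notin\mathcal T$. $X$ is $\mathcal T$-weak if contained in a member of $\mathcal T$, else $\mathcal T$-strong; a partition is $\mathcal T$-strong if all parts are. A $\mathcal T$-strong $k$-separating $X$ is fully closed if no non-empty $\mathcal T$-weak $Y\subseteq E-X$ has $X\cup Y$ $k$-separating; $\mathrm{fcl}_{\mathcal T}(X)$ is the intersection of all fully closed $k$-separating sets containing $X$. $\mathcal T$-strong $k$-separations $(X,Y),(X',Y')$ are $\mathcal T$-equivalent if $\{\mathrm{fcl}_{\mathcal T}(X),\mathrm{fcl}_{\mathcal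 T}(Y)\}=\{\mathrm{fcl}_{\mathcal T}(X'),\mathrm{fcl}_{\mathcal T}(Y')\}$. A $k$-separating $X$ is $\mathcal T$-sequential if $E-X$ is $\mathcal T$-strong and $\mathrm{fcl}_{\mathcal T}(E-X)=E$. Let $\mathcal S$ be a set of $k$-separating sets that are not $\mathcal T$-sequential and have $\mathcal T$-strong complements; a $(k,\mathcal S)$-separation is a $k$-separation with both sides in $\mathcal S$. $\mathcal S$ is tree compatible if (S1) any $\mathcal T$-strong $k$-separation $\mathcal T$-equivalent to a $(k,\mathcal S)$-separation is a $(k,\mathcal S)$-separation; (S2) if $X\in\mathcal S$ and $(Y,E-Y)$ is a $\mathcal T$-strong $k$-separation with $X\subseteq Y$, then $Y\in\mathcal S$. A $k$-flower in $\mathcal T$ is a $\mathcal T$-strong partition $(P_1,\dots,P_n)$ of $E$ with each $P_i$ and $P_i\cup P_{i+1}$ (indices mod $n$) $k$-separating; it displays $(X,E-X)$ if $X$ is a union of petals. For flowers, $\Phi_1\preccurlyeq_{\mathcal S}\Phi_2$ if every $(k,\mathcal S)$-separation displayed by $\Phi_1$ is $\mathcal T$-equivalent to a $(k,\mathcal S)$-separation displayed by $\Phi_2$; $\Phi_1,\Phi_2$ are $\mathcal T$-equivalent with respect to $\mathcal S$ if $\Phi_1\preccurlyeq_{\mathcal S}\Phi_2$ and $\Phi_2\preccurlyeq_{\mathcal S}\Phi_1$. -}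

module Defs where

open import Data.Nat using (ℕ; zero; suc)
import Data.Nat as ℕ
open import Data.Integer using (ℤ; +_; _+_; _≤_; _<_)
open import Data.Fin using (Fin; zero; suc; toℕ; lower₁)
open import Data.Fin.Subset using (Subset; _∈_; _∉_; _⊆_; _∪_; _∩_; ∁; ⊤; ⁅_⁆; Nonempty)
open import Data.Product using (Σ; ∃; _×_; _,_)
open import Data.Sum using (_⊎_)
open import Relation.Nullary using (¬_; yes; no)
open import Relation.Binary.PropositionalEquality using (_≡_)

-- The ground set E is Fin m; subsets of E are Data.Fin.Subset m.
-- A connectivity function: integer-valued, symmetric, submodular.
record IsConnectivity (m : ℕ) (conn : Subset m → ℤ) : Set where
  field
    symmetric  : ∀ X → conn X ≡ conn (∁ X)
    submodular : ∀ X Y → conn (X ∩ Y) + conn (X ∪ Y) ≤ conn X + conn Y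

_≐_ : ∀ {m} → (Fin m → Set) → (Fin m → Set) → Set
F ≐ G = ∀ e → (F e → G e) × (G e → F e)

module _ {m : ℕ} (conn : Subset m → ℤ) (k : ℕ) where

  KSep : Subset m → Set
  KSep X = conn X ≤ + k

  record IsTangle (T : Subset m → Set) : Set where
    field
      T1 : ∀ A → T A → conn A < + k
      T2 : ∀ A → conn A ≤ + k Data.Integer.- + 1 → T A ⊎ T (∁ A)
      T3 : ∀ A B C → T A → T B → T C → ¬ (A ∪ (B ∪ C) ≡ ⊤)
      T4 : ∀ e → ¬ T (∁ ⁅ e ⁆)

  module _ (T : Subset m → Set) where

    Weak : Subset m → Set
    Weak X = ∃ λ A → T A × X ⊆ A

    Strong : Subset m → Set
    Strong X = ¬ Weak X

    FullyClosed : Subset m → Set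
    FullyClosed X = KSep X × Strong X ×
      (∀ Y → Nonempty Y → Weak Y → Y ⊆ ∁ X → ¬ KSep (X ∪ Y))

    fcl : Subset m → Fin m → Set
    fcl X e = ∀ Z → FullyClosed Z → X ⊆ Z → e ∈ Z

    StrongSep : Subset m → Set
    StrongSep X = KSep X × Strong X × Strong (∁ X)

    Equiv : Subset m → Subset m → Set
    Equiv X X' =
      (fcl X ≐ fcl X' × fcl (∁ X) ≐ fcl (∁ X'))
      ⊎ (fcl X ≐ fcl (∁ X') × fcl (∁ X) ≐ fcl X')

    Sequential : Subset m → Set
    Sequential X = KSep X × Strong (∁ X) × (∀ e → fcl (∁ X) e)

    record IsAdmissible (S : Subset m → Set) : Set where
      field
        ksep   : ∀ X → S X → KSep X
        nonseq : ∀ X → S X → ¬ Sequential X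
        cstrong : ∀ X → S X → Strong (∁ X)

    module _ (S : Subset m → Set) where

      SSep : Subset m → Set
      SSep X = KSep X × S X × S (∁ X)

      record TreeCompatible : Set where
        field
          admissible : IsAdmissible S
          S1 : ∀ X X' → SSep X → StrongSep X' → Equiv X' X → SSep X'
          S2 : ∀ X Y → S X → StrongSep Y → X ⊆ Y → S Y

      UnionOfPetals : ∀ {n} → (Fin n → Subset m) → Subset m → Set
      UnionOfPetals {n} P X = ∃ λ (J : Subset n) →
        ∀ e → (e ∈ X → ∃ λ i → i ∈ J × e ∈ P i) × ((∃ λ i → i ∈ J × e ∈ P i) → e ∈ X)

      Displays : ∀ {n} → (Fin n → Subset m) → Subset m → Set
      Displays P X = UnionOfPetals P X

      _≼_ : ∀ {n₁ n₂} → (Fin n₁ → Subset m) → (Fin n₂ → Subset m) → Set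
      P₁ ≼ P₂ = ∀ X → SSep X → Displays P₁ X →
        ∃ λ X' → SSep X' × Displays P₂ X' × Equiv X X'

      FlowerEquiv : ∀ {n₁ n₂} → (Fin n₁ → Subset m) → (Fin n₂ → Subset m) → Set
      FlowerEquiv P₁ P₂ = (P₁ ≼ P₂) × (P₂ ≼ P₁)

next : ∀ {n} → Fin (suc n) → Fin (suc n)
next {n} i with n ℕ.≟ toℕ i
... | yes _ = zero
... | no ne = suc (lower₁ i ne)

module _ {m : ℕ} (conn : Subset m → ℤ) (k : ℕ) (T : Subset m → Set) where

  IsPartition : ∀ {n} → (Fin n → Subset m) → Set
  IsPartition P = (∀ e → ∃ λ i → e ∈ P i) × (∀ i j e → e ∈ P i → e ∈ P j → i ≡ j)

  IsFlower : ∀ {n'} → (Fin (suc n') → Subset m) → Set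
  IsFlower P = IsPartition P × (∀ i → Strong conn k T (P i))
    × (∀ i → KSep conn k (P i)) × (∀ i → KSep conn k (P i ∪ P (next i)))

-- concatenation (P₁ ∪ P₂, P₃, …, Pₙ) of a family with n = suc (suc n') petals
concat12 : ∀ {m n'} → (Fin (suc (suc n')) → Subset m) → Fin (suc n') → Subset m
concat12 P zero = P zero ∪ P (suc zero)
concat12 P (suc i) = P (suc (suc i))

module Submission where

-- Every set displayed by the concatenation is displayed by the original
-- flower, so one direction is immediate.  Conversely, a (k,S)-separation
-- (X, E-X) displayed by the flower either already keeps P₁ and P₂ together,
-- or (up to swapping sides) has P₂ ⊆ X and P₁ ⊆ E-X.  The heart of the proof
-- is the absorption lemma: then X ∪ P₁ is a T-strong k-separation with the
-- same full closures on both sides as X, hence by (S1) a T-equivalent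
-- (k,S)-separation, and it is displayed by the concatenation.

open import Defs
open import Data.Nat using (ℕ; suc)
open import Data.Integer using (ℤ)
open import Data.Fin using (Fin; zero; suc)
open import Data.Fin.Subset using (Subset; _∈_)

open import Algebra.Lattice.Properties.BooleanAlgebra as BooleanAlgebraProperties using ()
open import Data.Integer using (+_; _+_; _≤_)
import Data.Integer.Properties as ℤ
open import Data.Fin.Subset
  using (_∉_; _⊆_; _∪_; _∩_; ∁; ⊤; ⊥; _⊃_; Nonempty; inside; outside)
open import Data.Fin.Subset.Properties
open import Data.Fin.Subset.Induction using (⊃-wellFounded)
open import Data.Vec using (_∷_; here; there)
open import Data.Product using (∃; _×_; _,_; proj₁; proj₂; swap)
open import Data.Sum using (inj₁; inj₂; [_,_]′)
open import Data.Empty using (⊥-elim)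
open import Function using (_∘_; id)
open import Induction.WellFounded using (module All)
open import Relation.Nullary using (¬_; Dec; yes; no)
open import Relation.Nullary.Decidable using (_×-dec_)
open import Relation.Binary.PropositionalEquality
  using (_≡_; refl; sym; trans; cong; cong₂; subst; module ≡-Reasoning)

≤-from-sum : ∀ {K x y a b : ℤ} → x + y ≤ a + b → a ≤ K → b ≤ K → K ≤ x → y ≤ K
≤-from-sum x+y≤a+b a≤K b≤K K≤x = ℤ.≮⇒≥ λ K<y →
  ℤ.<-irrefl refl
    (ℤ.<-≤-trans (ℤ.+-mono-≤-< K≤x K<y) (ℤ.≤-trans x+y≤a+b (ℤ.+-mono-≤ a≤K b≤K)))

module _ {m : ℕ} where

  ≐-refl : {F : Fin m → Set} → F ≐ F
  ≐-refl e = id , id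

  ≐-sym : {F G : Fin m → Set} → F ≐ G → G ≐ F
  ≐-sym F≐G e = swap (F≐G e)

  ≐-trans : {F G H : Fin m → Set} → F ≐ G → G ≐ H → F ≐ H
  ≐-trans F≐G G≐H e =
    let (F→G , G→F) = F≐G e ; (G→H , H→G) = G≐H e in G→H ∘ F→G , G→F ∘ H→G

module _ {m : ℕ} where

  private
    module BA = BooleanAlgebraProperties (∪-∩-booleanAlgebra m)

  ∁-involutive : (A : Subset m) → ∁ (∁ A) ≡ A
  ∁-involutive = BA.¬-involutive

  ∁-⊤ : ∁ ⊤ ≡ ⊥
  ∁-⊤ = BA.¬⊤≈⊥

  ∪-absorbs-⊆ : {A B : Subset m} → B ⊆ A → A ∪ B ≡ A
  ∪-absorbs-⊆ B⊆A = ⊆-antisym (λ h → [ id , B⊆A ]′ (x∈p∪q⁻ _ _ h)) (p⊆p∪q _)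

  ∪-∩∁ : (A B : Subset m) → A ∪ (B ∩ ∁ A) ≡ A ∪ B
  ∪-∩∁ A B = begin
    A ∪ (B ∩ ∁ A)        ≡⟨ ∪-distribˡ-∩ A B (∁ A) ⟩
    (A ∪ B) ∩ (A ∪ ∁ A)  ≡⟨ cong ((A ∪ B) ∩_) (∪-inverseʳ A) ⟩
    (A ∪ B) ∩ ⊤          ≡⟨ ∩-identityʳ (A ∪ B) ⟩
    A ∪ B                ∎
    where open ≡-Reasoning

  ∪-∁∪ : (A X : Subset m) → A ∪ ∁ (X ∪ A) ≡ A ∪ ∁ X
  ∪-∁∪ A X = trans (cong (A ∪_) (BA.deMorgan₂ X A)) (∪-∩∁ A (∁ X))

  ∁-∪-intro : ∀ {A B : Subset m} {e} → e ∈ ∁ A → e ∈ ∁ B → e ∈ ∁ (A ∪ B)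
  ∁-∪-intro {A} {B} e∉A e∉B = x∉p⇒x∈∁p λ h →
    [ x∈∁p⇒x∉p e∉A , x∈∁p⇒x∉p e∉B ]′ (x∈p∪q⁻ A B h)

module Connectivity {m : ℕ} {conn : Subset m → ℤ} (isC : IsConnectivity m conn) (k : ℕ) where

  open IsConnectivity isC

  KS : Subset m → Set
  KS = KSep conn k

  KSep-∁ : ∀ {A} → KS A → KS (∁ A)
  KSep-∁ {A} = subst (_≤ + k) (symmetric A)

  λ∅≡λE : conn ⊥ ≡ conn ⊤
  λ∅≡λE = trans (cong conn (sym ∁-⊤)) (sym (symmetric ⊤))

  -- E is k-separating as soon as some Q is: 2λ(E) = λ(∅) + λ(E) ≤ λ(Q) + λ(E-Q).
  KSep-⊤ : ∀ {Q} → KS Q → KS ⊤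
  KSep-⊤ {Q} ksQ = [ id , ≤-from-sum twice-λE ksQ (KSep-∁ ksQ) ]′ (ℤ.≤-total (conn ⊤) (+ k))
    where
    twice-λE : conn ⊤ + conn ⊤ ≤ conn Q + conn (∁ Q)
    twice-λE = subst (_≤ conn Q + conn (∁ Q))
      (cong₂ _+_ (trans (cong conn (∩-inverseʳ Q)) λ∅≡λE) (cong conn (∪-inverseʳ Q)))
      (submodular Q (∁ Q))

  uncross : ∀ {A B} → KS A → KS B → + k ≤ conn (A ∩ B) → KS (A ∪ B)
  uncross {A} {B} ksA ksB = ≤-from-sum (submodular A B) ksA ksB

module Tangle {m : ℕ} {conn : Subset m → ℤ} (isC : IsConnectivity m conn)
  {k : ℕ} {T : Subset m → Set} (isT : IsTangle conn k T) where

  open Connectivity isC k public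
  open IsTangle isT

  Wk St FC : Subset m → Set
  Wk = Weak conn k T
  St = Strong conn k T
  FC = FullyClosed conn k T

  Fcl : Subset m → Fin m → Set
  Fcl = fcl conn k T

  weak-mono : ∀ {A B} → A ⊆ B → Wk B → Wk A
  weak-mono A⊆B (C , tC , B⊆C) = C , tC , B⊆C ∘ A⊆B

  strong-mono : ∀ {A B} → A ⊆ B → St A → St B
  strong-mono A⊆B stA = stA ∘ weak-mono A⊆B

  separates-strong : ∀ {A C D} → St C → C ⊆ A → St D → D ⊆ ∁ A → + k ≤ conn A
  separates-strong {A} stC C⊆A stD D⊆∁A = ℤ.≮⇒≥ λ λA<k →
    [ (λ tA → stC (A , tA , C⊆A)) , (λ t∁A → stD (∁ A , t∁A , D⊆∁A)) ]′
      (T2 A (ℤ.i<j⇒i≤pred[j] λA<k))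

  uncross-strong : ∀ {A B C D} → KS A → KS B → St C → C ⊆ A ∩ B → St D → D ⊆ ∁ (A ∩ B) →
    KS (A ∪ B)
  uncross-strong ksA ksB stC C⊆ stD D⊆ = uncross ksA ksB (separates-strong stC C⊆ stD D⊆)

  T-dec : ∀ A → Dec (T A)
  T-dec A with conn A ℤ.<? + k
  ... | no λA≮k = no (λA≮k ∘ T1 A)
  ... | yes λA<k = [ yes , (λ t∁A → no λ tA → T3 A (∁ A) (∁ A) tA t∁A t∁A covers) ]′
                     (T2 A (ℤ.i<j⇒i≤pred[j] λA<k))
    where
    covers : A ∪ (∁ A ∪ ∁ A) ≡ ⊤
    covers = trans (cong (A ∪_) (∪-idem (∁ A))) (∪-inverseʳ A)

  -- Needed to run the closure procedure below constructively.
  Weak-dec : ∀ V → Dec (Wk V)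
  Weak-dec V = anySubset? (λ B → T-dec B ×-dec (V ⊆? B))

  fully-closed-repels : ∀ {Z V e} → FC Z → Wk V → V ⊆ ∁ Z → KS (Z ∪ V) → e ∉ V
  fully-closed-repels (_ , _ , closed) wV V⊆∁Z ks e∈V = closed _ (_ , e∈V) wV V⊆∁Z ks

  fully-closed-weak-complement : ∀ {Z} → FC Z → Wk (∁ Z) → ∀ e → e ∈ Z
  fully-closed-weak-complement {Z} fc@(ksZ , _) w∁Z e =
    x∉∁p⇒x∈p (fully-closed-repels fc w∁Z id (subst KS (sym (∪-inverseʳ Z)) (KSep-⊤ ksZ)))

  fcl-extensive : ∀ {A} e → e ∈ A → Fcl A e
  fcl-extensive e e∈A Z _ A⊆Z = A⊆Z e∈A

  fcl-mono : ∀ {A B} → A ⊆ B → ∀ e → Fcl A e → Fcl B e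
  fcl-mono A⊆B e e∈fclA Z fcZ B⊆Z = e∈fclA Z fcZ (B⊆Z ∘ A⊆B)

  -- Absorption: a fully closed Z swallows a k-separating B when Z ∩ B is
  -- strong and B - Z is weak (else Z ∪ B = Z ∪ (B - Z) would extend Z).
  absorb : ∀ {Z B} → FC Z → KS B → St (Z ∩ B) → Wk (B ∩ ∁ Z) → B ⊆ Z
  absorb {Z} {B} fcZ@(ksZ , _) ksB stZ∩B wB-Z {e} e∈B with Weak-dec (∁ Z)
  ... | yes w∁Z = fully-closed-weak-complement fcZ w∁Z e
  ... | no st∁Z = x∉∁p⇒x∈p λ e∈∁Z →
          fully-closed-repels fcZ wB-Z (p∩q⊆q _ _) (subst KS (sym (∪-∩∁ Z B)) ksZ∪B)
            (x∈p∩q⁺ (e∈B , e∈∁Z))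
    where
    ksZ∪B : KS (Z ∪ B)
    ksZ∪B = uncross-strong ksZ ksB stZ∩B id st∁Z (p⊆q⇒∁p⊇∁q (p∩q⊆p _ _))

  -- Starting from a strong k-separating A₀, repeatedly
  -- add weak extensions; every set reached lies inside fcl(A₀), and the
  -- process ends in a fully closed set.  A property holding at the end and
  -- pulled back along each extension therefore holds at A₀.
  module Closure {A₀ : Subset m} (stA₀ : St A₀) (ksA₀ : KS A₀) where

    record Approx (A : Subset m) : Set where
      field
        base  : A₀ ⊆ A
        ksep  : KS A
        below : ∀ {e} → e ∈ A → Fcl A₀ e

    open Approx

    Extension : Subset m → Subset m → Set
    Extension A V = Nonempty V × Wk V × V ⊆ ∁ A × KS (A ∪ V)

    extension-dec : ∀ A → Dec (∃ (Extension A))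
    extension-dec A = anySubset? λ V →
      nonempty? V ×-dec Weak-dec V ×-dec (V ⊆? ∁ A) ×-dec KSep-dec (A ∪ V)
      where
      KSep-dec : ∀ B → Dec (KS B)
      KSep-dec B = conn B ℤ.≤? + k

    extension-grows : ∀ {A V} → Extension A V → (A ∪ V) ⊃ A
    extension-grows ((e , e∈V) , _ , V⊆∁A , _) =
      p⊆p∪q _ , e , q⊆p∪q _ _ e∈V , x∈∁p⇒x∉p (V⊆∁A e∈V)

    -- Extending stays inside fcl(A₀): each fully closed Z ⊇ A₀ absorbs A ∪ V.
    approx-extend : ∀ {A V} → Approx A → Extension A V → Approx (A ∪ V)
    approx-extend {A} {V} apx (_ , wV , _ , ksA∪V) = record
      { base  = p⊆p∪q _ ∘ base apx
      ; ksep  = ksA∪V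
      ; below = λ e∈A∪V Z fcZ A₀⊆Z → A∪V⊆ Z fcZ A₀⊆Z e∈A∪V
      }
      where
      A∪V⊆ : ∀ Z → FC Z → A₀ ⊆ Z → A ∪ V ⊆ Z
      A∪V⊆ Z fcZ A₀⊆Z = absorb fcZ ksA∪V
        (strong-mono (λ a₀ → x∈p∩q⁺ (A₀⊆Z a₀ , p⊆p∪q _ (base apx a₀))) stA₀)
        (weak-mono outside-Z-in-V wV)
        where
        outside-Z-in-V : (A ∪ V) ∩ ∁ Z ⊆ V
        outside-Z-in-V h = [ (λ a → ⊥-elim (x∈∁p⇒x∉p (p∩q⊆q _ _ h) (below apx a Z fcZ A₀⊆Z))) , id ]′
          (x∈p∪q⁻ _ _ (p∩q⊆p _ _ h))

    approx-closed : ∀ {A} → Approx A → ¬ ∃ (Extension A) → FC A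
    approx-closed apx none =
      ksep apx , strong-mono (base apx) stA₀ , λ V ne wV V⊆∁A ks → none (V , ne , wV , V⊆∁A , ks)

    closure-induction : (Q : Subset m → Set) →
      (∀ {A} → Approx A → FC A → Q A) →
      (∀ {A V} → Approx A → Extension A V → Q (A ∪ V) → Q A) →
      Q A₀
    closure-induction Q closed step =
      All.wfRec ⊃-wellFounded _ (λ A → Approx A → Q A) go A₀ start
      where
      go : ∀ A → (∀ {A'} → A' ⊃ A → Approx A' → Q A') → Approx A → Q A
      go A ih apx with extension-dec A
      ... | yes (V , ext) = step apx ext (ih (extension-grows ext) (approx-extend apx ext))
      ... | no none = closed apx (approx-closed apx none)

      start : Approx A₀
      start = record { base = id ; ksep = ksA₀ ; below = fcl-extensive _ }

module Absorption {m : ℕ} {conn : Subset m → ℤ} (isC : IsConnectivity m conn)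
  {k : ℕ} {T : Subset m → Set} (isT : IsTangle conn k T)
  {S : Subset m → Set} (tc : TreeCompatible conn k T S)
  {P₁ P₂ : Subset m} (stP₁ : Strong conn k T P₁) (stP₂ : Strong conn k T P₂)
  (ksP₂ : KSep conn k P₂) (ksP₁∪P₂ : KSep conn k (P₁ ∪ P₂))
  (P₁⊆fclP₂ : ∀ e → e ∈ P₁ → fcl conn k T P₂ e) where

  open Tangle isC isT
  open TreeCompatible tc
  open IsAdmissible admissible
  open Closure stP₂ ksP₂ using (closure-induction; Extension; Approx; module Approx)
  open Approx

  module _ {X : Subset m} (sepX : SSep conn k T S X) (P₂⊆X : P₂ ⊆ X) (P₁⊆∁X : P₁ ⊆ ∁ X) where

    private
      ksX : KS X
      ksX = let (ksX , _ , _) = sepX in ksX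

      sX : S X
      sX = let (_ , sX , _) = sepX in sX

      s∁X : S (∁ X)
      s∁X = let (_ , _ , s∁X) = sepX in s∁X

    X' : Subset m
    X' = X ∪ P₁

    ∁X-strong : St (∁ X)
    ∁X-strong = cstrong X sX

    X-strong : St X
    X-strong = subst St (∁-involutive X) (cstrong (∁ X) s∁X)

    -- E - X is not T-sequential, i.e. fcl(X) ≠ E.
    fcl-X-proper : ¬ (∀ e → Fcl X e)
    fcl-X-proper fclX=E = nonseq (∁ X) s∁X
      ( KSep-∁ ksX
      , subst St (sym (∁-involutive X)) X-strong
      , λ e → subst (λ W → Fcl W e) (sym (∁-involutive X)) (fclX=E e) )

    -- fcl(X ∪ P₁) = fcl(X): a fully closed set containing X contains P₂, hence P₁.
    fcl-X'⊆fcl-X : ∀ e → Fcl X' e → Fcl X e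
    fcl-X'⊆fcl-X e e∈fclX' Z fcZ X⊆Z = e∈fclX' Z fcZ λ h →
      [ X⊆Z , (λ p₁ → P₁⊆fclP₂ _ p₁ Z fcZ (X⊆Z ∘ P₂⊆X)) ]′ (x∈p∪q⁻ _ _ h)

    -- X ∪ P₁ = X ∪ (P₁ ∪ P₂) is k-separating: uncross X with P₁ ∪ P₂ across P₂ and E - X.
    X'-ksep : KS X'
    X'-ksep = subst KS X∪P₁∪P₂≡X'
      (uncross-strong ksX ksP₁∪P₂ stP₂ (λ p₂ → x∈p∩q⁺ (P₂⊆X p₂ , q⊆p∪q _ _ p₂))
        ∁X-strong (p⊆q⇒∁p⊇∁q (p∩q⊆p _ _)))
      where
      open ≡-Reasoning
      X∪P₁∪P₂≡X' : X ∪ (P₁ ∪ P₂) ≡ X'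
      X∪P₁∪P₂≡X' = begin
        X ∪ (P₁ ∪ P₂)  ≡⟨ cong (X ∪_) (∪-comm P₁ P₂) ⟩
        X ∪ (P₂ ∪ P₁)  ≡⟨ ∪-assoc X P₂ P₁ ⟨
        (X ∪ P₂) ∪ P₁  ≡⟨ cong (_∪ P₁) (∪-absorbs-⊆ P₂⊆X) ⟩
        X ∪ P₁         ∎

    X'-strong : St X'
    X'-strong = strong-mono (p⊆p∪q _) X-strong

    -- If E - X' were weak, every fully closed set containing X' would be E,
    -- so fcl(X) = fcl(X') = E.
    ∁X'-strong : St (∁ X')
    ∁X'-strong w∁X' = fcl-X-proper λ e → fcl-X'⊆fcl-X e λ Z fcZ X'⊆Z →
      fully-closed-weak-complement fcZ (weak-mono (p⊆q⇒∁p⊇∁q X'⊆Z) w∁X') e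

    -- The key step: every fully closed Z ⊇ E - X' contains E - X.  Walk from
    -- P₂ up to a fully closed A ⊆ fcl(P₂) and show that E - (X ∪ A) is a strong
    -- subset of Z at every stage.
    ∁X⊆fully-closed : ∀ {Z} → FC Z → ∁ X' ⊆ Z → ∁ X ⊆ Z
    ∁X⊆fully-closed {Z} fcZ ∁X'⊆Z =
      subst (_⊆ Z) (cong ∁ (∪-absorbs-⊆ P₂⊆X)) (proj₁ (closure-induction Inside at-end pull-back))
      where
      Inside : Subset m → Set
      Inside A = ∁ (X ∪ A) ⊆ Z × St (∁ (X ∪ A))

      -- At a fully closed A, P₁ ⊆ A, so E - (X ∪ A) ⊆ E - X' ⊆ Z; and if it
      -- were weak, A would absorb it, making X ∪ A = E and fcl(X) = E.
      at-end : ∀ {A} → Approx A → FC A → Inside A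
      at-end {A} apx fcA = ∁X'⊆Z ∘ p⊆q⇒∁p⊇∁q X'⊆X∪A , strong
        where
        P₁⊆A : P₁ ⊆ A
        P₁⊆A p₁ = P₁⊆fclP₂ _ p₁ A fcA (base apx)

        X'⊆X∪A : X' ⊆ X ∪ A
        X'⊆X∪A h = [ p⊆p∪q _ , q⊆p∪q _ _ ∘ P₁⊆A ]′ (x∈p∪q⁻ _ _ h)

        A∪∁X-ksep : KS (A ∪ ∁ (X ∪ A))
        A∪∁X-ksep = subst KS (sym (∪-∁∪ A X))
          (uncross-strong (ksep apx) (KSep-∁ ksX) stP₁ (λ p₁ → x∈p∩q⁺ (P₁⊆A p₁ , P₁⊆∁X p₁))
            X-strong (λ x → x∉p⇒x∈∁p λ h → x∈∁p⇒x∉p (p∩q⊆q _ _ h) x))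

        strong : St (∁ (X ∪ A))
        strong w = fcl-X-proper λ e →
          [ fcl-extensive e , (λ a → fcl-mono P₂⊆X e (below apx a)) ]′
            (x∈p∪q⁻ _ _ (x∉∁p⇒x∈p
              (fully-closed-repels fcA w (p⊆q⇒∁p⊇∁q (q⊆p∪q _ _)) A∪∁X-ksep)))

      -- Adding a weak V to A: B = E - (X ∪ A) is k-separating, B ∩ Z contains
      -- the strong E - (X ∪ A ∪ V), and B - Z ⊆ V is weak, so Z absorbs B.
      pull-back : ∀ {A V} → Approx A → Extension A V → Inside (A ∪ V) → Inside A
      pull-back {A} {V} apx (_ , wV , _ , _) (B'⊆Z , stB') =
        absorb fcZ B-ksep (strong-mono (λ b' → x∈p∩q⁺ (B'⊆Z b' , B'⊆B b')) stB') (weak-mono B-Z⊆V wV)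
        , strong-mono B'⊆B stB'
        where
        B'⊆B : ∁ (X ∪ (A ∪ V)) ⊆ ∁ (X ∪ A)
        B'⊆B = p⊆q⇒∁p⊇∁q (λ h → subst (_ ∈_) (∪-assoc X A V) (p⊆p∪q V h))

        B-ksep : KS (∁ (X ∪ A))
        B-ksep = KSep-∁ (uncross-strong ksX (ksep apx) stP₂ (λ p₂ → x∈p∩q⁺ (P₂⊆X p₂ , base apx p₂))
          ∁X-strong (p⊆q⇒∁p⊇∁q (p∩q⊆p _ _)))

        B-Z⊆V : ∁ (X ∪ A) ∩ ∁ Z ⊆ V
        B-Z⊆V h = x∉∁p⇒x∈p λ e∈∁V → x∈∁p⇒x∉p (p∩q⊆q _ _ h)
          (B'⊆Z (subst (λ W → _ ∈ ∁ W) (∪-assoc X A V) (∁-∪-intro (p∩q⊆p _ _ h) e∈∁V)))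

    fcl-∁X⊆fcl-∁X' : ∀ e → Fcl (∁ X) e → Fcl (∁ X') e
    fcl-∁X⊆fcl-∁X' e e∈fcl∁X Z fcZ ∁X'⊆Z = e∈fcl∁X Z fcZ (∁X⊆fully-closed fcZ ∁X'⊆Z)

    absorb-petal : SSep conn k T S X' × Equiv conn k T X X'
    absorb-petal =
      S1 X X' sepX (X'-ksep , X'-strong , ∁X'-strong) (inj₁ (≐-sym fcl-X≐ , ≐-sym fcl-∁X≐))
      , inj₁ (fcl-X≐ , fcl-∁X≐)
      where
      fcl-X≐ : Fcl X ≐ Fcl X'
      fcl-X≐ e = fcl-mono (p⊆p∪q _) e , fcl-X'⊆fcl-X e

      fcl-∁X≐ : Fcl (∁ X) ≐ Fcl (∁ X')
      fcl-∁X≐ e = fcl-∁X⊆fcl-∁X' e , fcl-mono (p⊆q⇒∁p⊇∁q (p⊆p∪q _)) e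

Equiv-∁ : ∀ {m} {conn : Subset m → ℤ} {k T X Y} → Equiv conn k T (∁ X) Y → Equiv conn k T X Y
Equiv-∁ {X = X} equiv with ∁ (∁ X) | ∁-involutive X | equiv
... | _ | refl | inj₁ (fcl∁X≐fclY , fclX≐fcl∁Y) = inj₂ (fclX≐fcl∁Y , fcl∁X≐fclY)
... | _ | refl | inj₂ (fcl∁X≐fcl∁Y , fclX≐fclY) = inj₁ (fclX≐fclY , fcl∁X≐fcl∁Y)

SSep-∁ : ∀ {m} {conn : Subset m → ℤ} → IsConnectivity m conn →
  ∀ {k T S X} → SSep conn k T S X → SSep conn k T S (∁ X)
SSep-∁ isC {k} {S = S} {X} (ksX , sX , s∁X) =
  Connectivity.KSep-∁ isC k ksX , s∁X , subst S (sym (∁-involutive X)) sX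

-- The elements of E lying in some petal P i with i ∈ J; X is displayed by
-- P via J when (_∈ X) ≐ PetalUnion P J.
PetalUnion : ∀ {m n} → (Fin n → Subset m) → Subset n → Fin m → Set
PetalUnion P J e = ∃ λ i → i ∈ J × e ∈ P i

module _ {m n : ℕ} {P : Fin n → Subset m} where

  petal-⊆ : ∀ {X J i} → (_∈ X) ≐ PetalUnion P J → i ∈ J → P i ⊆ X
  petal-⊆ {i = i} X≐ i∈J e∈Pᵢ = proj₂ (X≐ _) (i , i∈J , e∈Pᵢ)

  complement-petals : (∀ e → ∃ λ i → e ∈ P i) → (∀ i j e → e ∈ P i → e ∈ P j → i ≡ j) →
    ∀ {X J} → (_∈ X) ≐ PetalUnion P J → (_∈ ∁ X) ≐ PetalUnion P (∁ J)
  complement-petals cover disjoint {X} {J} X≐ e = to , from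
    where
    to : e ∈ ∁ X → PetalUnion P (∁ J) e
    to e∈∁X = let (i , e∈Pᵢ) = cover e in
      i , x∉p⇒x∈∁p (λ i∈J → x∈∁p⇒x∉p e∈∁X (petal-⊆ X≐ i∈J e∈Pᵢ)) , e∈Pᵢ

    from : PetalUnion P (∁ J) e → e ∈ ∁ X
    from (i , i∈∁J , e∈Pᵢ) = x∉p⇒x∈∁p λ e∈X →
      let (j , j∈J , e∈Pⱼ) = proj₁ (X≐ e) e∈X in
      x∈∁p⇒x∉p i∈∁J (subst (_∈ J) (sym (disjoint i j e e∈Pᵢ e∈Pⱼ)) j∈J)

module _ {m n' : ℕ} {P : Fin (suc (suc n')) → Subset m} where

  merge→ : ∀ {s J e} → PetalUnion P (s ∷ s ∷ J) e → PetalUnion (concat12 P) (s ∷ J) e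
  merge→ (zero , here , e∈P₁) = zero , here , p⊆p∪q _ e∈P₁
  merge→ (suc zero , there here , e∈P₂) = zero , here , q⊆p∪q _ _ e∈P₂
  merge→ (suc (suc i) , there (there i∈J) , e∈Pᵢ) = suc i , there i∈J , e∈Pᵢ

  merge← : ∀ {s J e} → PetalUnion (concat12 P) (s ∷ J) e → PetalUnion P (s ∷ s ∷ J) e
  merge← (zero , here , e∈P₁∪P₂) =
    [ (λ e∈P₁ → zero , here , e∈P₁) , (λ e∈P₂ → suc zero , there here , e∈P₂) ]′
      (x∈p∪q⁻ _ _ e∈P₁∪P₂)
  merge← (suc i , there i∈J , e∈Pᵢ) = suc (suc i) , there (there i∈J) , e∈Pᵢ

  merge-petals : ∀ {s J} → PetalUnion P (s ∷ s ∷ J) ≐ PetalUnion (concat12 P) (s ∷ J)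
  merge-petals e = merge→ , merge←

  add-first-petal : ∀ {X J} → (_∈ X) ≐ PetalUnion P (outside ∷ J) →
    (_∈ X ∪ P zero) ≐ PetalUnion P (inside ∷ J)
  add-first-petal {X} {J} X≐ e = to , from
    where
    to : e ∈ X ∪ P zero → PetalUnion P (inside ∷ J) e
    to h = [ (λ e∈X → let (i , i∈ , e∈Pᵢ) = proj₁ (X≐ e) e∈X in i , out⊆ id i∈ , e∈Pᵢ)
           , (λ e∈P₁ → zero , here , e∈P₁) ]′ (x∈p∪q⁻ _ _ h)

    from : PetalUnion P (inside ∷ J) e → e ∈ X ∪ P zero
    from (zero , here , e∈P₁) = q⊆p∪q _ _ e∈P₁
    from (suc i , there i∈J , e∈Pᵢ) = p⊆p∪q _ (petal-⊆ X≐ (there i∈J) e∈Pᵢ)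

module Concatenation {m : ℕ} {conn : Subset m → ℤ} (isC : IsConnectivity m conn)
  {k : ℕ} {T : Subset m → Set} (isT : IsTangle conn k T)
  {S : Subset m → Set} (tc : TreeCompatible conn k T S)
  {n' : ℕ} {P : Fin (suc (suc n')) → Subset m}
  (cover : ∀ e → ∃ λ i → e ∈ P i) (disjoint : ∀ i j e → e ∈ P i → e ∈ P j → i ≡ j)
  (strong : ∀ i → Strong conn k T (P i))
  (ksP₂ : KSep conn k (P (suc zero))) (ksP₁∪P₂ : KSep conn k (P zero ∪ P (suc zero)))
  (P₁⊆fclP₂ : ∀ e → e ∈ P zero → fcl conn k T (P (suc zero)) e) where

  open Absorption isC isT tc (strong zero) (strong (suc zero)) ksP₂ ksP₁∪P₂ P₁⊆fclP₂
    using (absorb-petal)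

  Replacement : Subset m → Set
  Replacement X =
    ∃ λ X' → SSep conn k T S X' × Displays conn k T S (concat12 P) X' × Equiv conn k T X X'

  unchanged : ∀ {X s J} → SSep conn k T S X → (_∈ X) ≐ PetalUnion P (s ∷ s ∷ J) → Replacement X
  unchanged {X} {s} {J} sepX X≐ =
    X , sepX , (s ∷ J , ≐-trans X≐ merge-petals) , inj₁ (≐-refl , ≐-refl)

  absorbed : ∀ {X J} → SSep conn k T S X → (_∈ X) ≐ PetalUnion P (outside ∷ inside ∷ J) →
    Replacement X
  absorbed {X} {J} sepX X≐ =
    let (sepX' , X≃X') = absorb-petal sepX P₂⊆X P₁⊆∁X in
    X ∪ P zero , sepX' , (inside ∷ J , ≐-trans (add-first-petal X≐) merge-petals) , X≃X'
    where
    P₂⊆X : P (suc zero) ⊆ X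
    P₂⊆X = petal-⊆ X≐ (there here)

    P₁⊆∁X : P zero ⊆ ∁ X
    P₁⊆∁X = petal-⊆ (complement-petals cover disjoint X≐) here

  concat≼P : _≼_ conn k T S (concat12 P) P
  concat≼P X sepX (s ∷ J , X≐) =
    X , sepX , (s ∷ s ∷ J , ≐-trans X≐ (≐-sym merge-petals)) , inj₁ (≐-refl , ≐-refl)

  -- Split on which of P₁, P₂ the displayed side contains; if it contains P₁
  -- but not P₂, apply the absorption case to the other side.
  P≼concat : _≼_ conn k T S P (concat12 P)
  P≼concat X sepX (inside ∷ inside ∷ J , X≐) = unchanged sepX X≐
  P≼concat X sepX (outside ∷ outside ∷ J , X≐) = unchanged sepX X≐
  P≼concat X sepX (outside ∷ inside ∷ J , X≐) = absorbed sepX X≐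
  P≼concat X sepX (inside ∷ outside ∷ J , X≐) =
    let (X' , sepX' , displayed , ∁X≃X') =
          absorbed (SSep-∁ isC {k} {T} {S} sepX) (complement-petals cover disjoint X≐)
    in X' , sepX' , displayed , Equiv-∁ ∁X≃X'

lemma4p3 : (m : ℕ) (conn : Subset m → ℤ) → IsConnectivity m conn →
    (k : ℕ) (T : Subset m → Set) → IsTangle conn k T →
    (S : Subset m → Set) → TreeCompatible conn k T S →
    (n' : ℕ) (P : Fin (suc (suc n')) → Subset m) → IsFlower conn k T P →
    (∀ e → e ∈ P zero → fcl conn k T (P (suc zero)) e) →
    FlowerEquiv conn k T S (concat12 P) P
lemma4p3 m conn isC k T isT S tc n' P ((cover , disjoint) , strong , ksep , ksep-next) P₁⊆fclP₂ =
  concat≼P , P≼concat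
  where
  open Concatenation isC isT tc cover disjoint strong (ksep (suc zero)) (ksep-next zero) P₁⊆fclP₂
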